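{- Let $T$ be an irreducible triangulation endowed with its minimal transversal edge-partition, and let $A$ be the ternary tree obtained by the opening of $T$, endowed with the induced edge-bicoloration. Then each ccw-internal red (respectively blue) edge of $T$ corresponds, via the opening, to an internal red (respectively blue) edge of $A$.
   Context: An irreducible triangulation is a plane graph with quadrangular outer face, triangular inner faces and no separating triangle. A transversal edge-partition colors inner edges red/blue so that around each inner vertex the edges form in clockwise order nonempty intervals red, blue, red, blue, and, with outer vertices $a_1,\dots,a_4$ clockwise, inner edges at $a_1,a_3$ have one color and those at $a_2,a_4$ the other. It is minimal if it has no right alternating 4-cycle (a 4-cycle with alternating colors such that every edge inside it incident to a cycle vertex $v$ has the color of the cycle edge starting at $v$ with the exterior on its right). The opening of $T$: endow $T$ with its minimal edge-partition, remove the outer quadrangle and all half-edges incident to its vertices, then remove every half-edge whose clockwise-consecutive half-edge around its vertex in $T$ has the same color; the result is a ternary tree $A$ (plane tree with vertex degrees in $\{1,4\}$), whose edges keep their colors; edges with both half-edges kept are closed edges, those with one half-edge kept are stems. A ccw-internal edge of $T$ is an inner edge $e$ such that the counterclockwise-consecutive edge at each extremity of $e$ has the same color as $e$. An internal edge of $A$ is a closed edge $e$ such that the edge following $e$ in clockwise order around each extremity of $e$ is a closed edge. -}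

module Defs where

open import Data.Nat using (ℕ; zero; suc; _+_; _*_; _≤_; _<_; _≤ᵇ_)
open import Data.Fin using (Fin; toℕ)
open import Data.Bool using (Bool; true; false; if_then_else_)
open import Data.List using (List; []; _∷_; upTo; allFin; map)
open import Data.Bool.ListAction using (all)
open import Data.Nat.ListAction using (sum)
open import Data.Product using (Σ; ∃; ∃-syntax; _×_; _,_)
open import Data.Sum using (_⊎_)
open import Relation.Nullary using (¬_)
open import Data.Empty using (⊥)
open import Relation.Binary.PropositionalEquality using (_≡_; _≢_)

-- Darts (half-edges) are Fin n.
--   α : the opposite half-edge (fixed-point-free involution)
--   σ : the CLOCKWISE-next half-edge around the same vertex
--   σ⁻ : its inverse (counterclockwise-next)
-- Vertices are σ-orbits, edges are α-orbits, faces are φ-orbits with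
-- φ = σ ∘ α ; the φ-orbit of a dart d is the face on the LEFT of d
-- (d directed from its own vertex to the vertex of α d).

iter : {A : Set} → (A → A) → ℕ → A → A
iter f zero    x = x
iter f (suc k) x = f (iter f k x)

record Map : Set where
  field
    n    : ℕ
    α    : Fin n → Fin n
    σ    : Fin n → Fin n
    σ⁻   : Fin n → Fin n
    α-invol : ∀ d → α (α d) ≡ d
    α-nofix : ∀ d → α d ≢ d
    σσ⁻  : ∀ d → σ (σ⁻ d) ≡ d
    σ⁻σ  : ∀ d → σ⁻ (σ d) ≡ d

data Color : Set where
  red blue : Color

flip : Color → Color
flip red  = blue
flip blue = red

module MapDefs (M : Map) where
  open Map M public

  Dart : Set
  Dart = Fin n

  φ : Dart → Dart
  φ d = σ (α d)

  SameVertex : Dart → Dart → Set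
  SameVertex d d' = ∃[ k ] iter σ k d ≡ d'

  SameFace : Dart → Dart → Set
  SameFace d d' = ∃[ k ] iter φ k d ≡ d'

  OrbitLength : (Dart → Dart) → Dart → ℕ → Set
  OrbitLength f d k =
    (0 < k) × (iter f k d ≡ d) × (∀ j → 0 < j → j < k → iter f j d ≢ d)

  -- number of orbits of a permutation f : count the darts which are
  -- minimal (w.r.t. toℕ) in their orbit (orbits have length ≤ n)
  isOrbitMin : (Dart → Dart) → Dart → Bool
  isOrbitMin f d = all (λ k → toℕ d ≤ᵇ toℕ (iter f k d)) (upTo n)

  numOrbits : (Dart → Dart) → ℕ
  numOrbits f = sum (map (λ d → if isOrbitMin f d then 1 else 0) (allFin n))

  data Reach : Dart → Dart → Set where
    here  : ∀ {d} → Reach d d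
    viaα  : ∀ {d d'} → Reach (α d) d' → Reach d d'
    viaσ  : ∀ {d d'} → Reach (σ d) d' → Reach d d'

  Connected : Set
  Connected = ∀ d d' → Reach d d'

  -- planar (genus 0): Euler's formula V - E + F = 2 with E = n/2,
  -- written as 2V + 2F = n + 4
  Planar : Set
  Planar = Connected × (2 * (numOrbits σ + numOrbits φ) ≡ n + 4)

  -- simple graph : no loops, no multiple edges
  Simple : Set
  Simple = (∀ d → ¬ SameVertex d (α d))
         × (∀ d d' → SameVertex d d' → SameVertex (α d) (α d') → d ≡ d')

  -- Cycles.  A k-cycle is given by darts e i (i : Fin k), e i going from
  -- its own vertex to the vertex of e (nxt i); the k vertices are distinct.

  IsCycle : {k : ℕ} → (Fin k → Fin k) → (Fin k → Dart) → Set
  IsCycle nxt e = (∀ i → SameVertex (α (e i)) (e (nxt i)))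
                × (∀ i j → SameVertex (e i) (e j) → i ≡ j)

  OnCycle : {k : ℕ} → (Fin k → Dart) → Dart → Set
  OnCycle e d = ∃[ i ] ((d ≡ e i) ⊎ (d ≡ α (e i)))

  -- the set of darts whose (left) face lies in the region on the left of
  -- the cycle: faces reachable from the face left of e i₀ without
  -- crossing a cycle edge
  data LeftOf {k : ℕ} (e : Fin k → Dart) (i₀ : Fin k) : Dart → Set where
    start : LeftOf e i₀ (e i₀)
    face  : ∀ {d} → LeftOf e i₀ d → LeftOf e i₀ (φ d)
    cross : ∀ {d} → LeftOf e i₀ d → ¬ OnCycle e d → LeftOf e i₀ (α d)

  nxt3 : Fin 3 → Fin 3
  nxt3 Fin.zero = Fin.suc Fin.zero
  nxt3 (Fin.suc Fin.zero) = Fin.suc (Fin.suc Fin.zero)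
  nxt3 (Fin.suc (Fin.suc Fin.zero)) = Fin.zero

  nxt4 : Fin 4 → Fin 4
  nxt4 Fin.zero = Fin.suc Fin.zero
  nxt4 (Fin.suc Fin.zero) = Fin.suc (Fin.suc Fin.zero)
  nxt4 (Fin.suc (Fin.suc Fin.zero)) = Fin.suc (Fin.suc (Fin.suc Fin.zero))
  nxt4 (Fin.suc (Fin.suc (Fin.suc Fin.zero))) = Fin.zero

  SeparatingTriangle : (Fin 3 → Dart) → Set
  SeparatingTriangle t =
    IsCycle nxt3 t
    × (∃[ w ] ((∀ i → ¬ SameVertex (t i) w) × LeftOf t Fin.zero w))
    × (∃[ w ] ((∀ i → ¬ SameVertex (t i) w) × ¬ LeftOf t Fin.zero w))

  -- The outer face is the face on the left of the dart o.

  module Outer (o : Dart) where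

    a : Fin 4 → Dart
    a i = iter φ (toℕ i) o

    OuterVertex : Dart → Set
    OuterVertex d = ∃[ i ] SameVertex (a i) d

    InnerEdge : Dart → Set
    InnerEdge d = ¬ SameFace o d × ¬ SameFace o (α d)

    record IrreducibleTriangulation : Set where
      field
        planar      : Planar
        simple      : Simple
        outerQuad   : OrbitLength φ o 4
        innerTri    : ∀ d → ¬ SameFace o d → OrbitLength φ d 3
        noSepTri    : ∀ t → ¬ SeparatingTriangle t

    FourIntervals : (Dart → Color) → Dart → ℕ → ℕ → ℕ → ℕ → Set
    FourIntervals col d₀ r₁ b₁ r₂ b₂ =
      OrbitLength σ d₀ (r₁ + b₁ + r₂ + b₂)
      × 0 < r₁ × 0 < b₁ × 0 < r₂ × 0 < b₂
      × (∀ j → j < r₁ → col (iter σ j d₀) ≡ red)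
      × (∀ j → r₁ ≤ j → j < r₁ + b₁ → col (iter σ j d₀) ≡ blue)
      × (∀ j → r₁ + b₁ ≤ j → j < r₁ + b₁ + r₂ → col (iter σ j d₀) ≡ red)
      × (∀ j → r₁ + b₁ + r₂ ≤ j → j < r₁ + b₁ + r₂ + b₂
              → col (iter σ j d₀) ≡ blue)

    -- col colours darts; only its values on inner edges matter
    record Transversal (col : Dart → Color) : Set where
      field
        edgeColour : ∀ d → InnerEdge d → col (α d) ≡ col d
        innerVertex : ∀ d → ¬ OuterVertex d →
          ∃[ d₀ ] ∃[ r₁ ] ∃[ b₁ ] ∃[ r₂ ] ∃[ b₂ ]
            (SameVertex d d₀ × FourIntervals col d₀ r₁ b₁ r₂ b₂)
        outerVertices : ∃[ c ] (∀ d → InnerEdge d →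
            ((SameVertex (a Fin.zero) d ⊎ SameVertex (a (Fin.suc (Fin.suc Fin.zero))) d)
                → col d ≡ c)
          × ((SameVertex (a (Fin.suc Fin.zero)) d
                ⊎ SameVertex (a (Fin.suc (Fin.suc (Fin.suc Fin.zero)))) d)
                → col d ≡ flip c))

    -- a right alternating 4-cycle e₀ e₁ e₂ e₃ (traversed with the
    -- exterior, i.e. the outer face, on its right, so its interior is the
    -- region on its left)
    RightAlternating4Cycle : (Dart → Color) → (Fin 4 → Dart) → Set
    RightAlternating4Cycle col e =
      IsCycle nxt4 e
      × (∀ i → InnerEdge (e i))
      × (∀ i → col (e i) ≢ col (e (nxt4 i)))
      × ¬ LeftOf e Fin.zero o
      × (∀ i d → SameVertex (e i) d → ¬ OnCycle e d → LeftOf e Fin.zero d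
             → col d ≡ col (e i))

    Minimal : (Dart → Color) → Set
    Minimal col = ∀ e → ¬ RightAlternating4Cycle col e

    CcwInternal : (Dart → Color) → Dart → Set
    CcwInternal col d =
      InnerEdge d
      × (InnerEdge (σ⁻ d) × col (σ⁻ d) ≡ col d)
      × (InnerEdge (σ⁻ (α d)) × col (σ⁻ (α d)) ≡ col (α d))

    -- The opening.  Kept half-edges: not at an outer vertex, and whose
    -- clockwise-consecutive half-edge in T has a different colour.
    module Opening (col : Dart → Color) where

      Kept : Dart → Set
      Kept d = ¬ OuterVertex d × col (σ d) ≢ col d

      Closed : Dart → Set
      Closed d = Kept d × Kept (α d)

      NextInA : Dart → Dart → Set
      NextInA h h' = ∃[ k ] (0 < k × iter σ k h ≡ h' × Kept h'
                       × (∀ j → 0 < j → j < k → ¬ Kept (iter σ j h)))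

      colA : Dart → Color
      colA = col

      InternalA : Dart → Set
      InternalA d = Closed d
                  × (∀ h → NextInA d h → Closed h)
                  × (∀ h → NextInA (α d) h → Closed h)

{-# OPTIONS --safe #-}
module Submission where

-- Give the outer edge a i a (i+1) the colour of the inner edges at a i and count the corners where a
-- blue edge is followed clockwise by a red one around a vertex. Every inner vertex has at least two
-- (its four intervals), every outer vertex at least one, an inner triangle at most one and the outer
-- quadrangle at most two; with Euler's formula and the face degrees these bounds leave no slack, so no
-- inner triangle is monochromatic, as it would have no such corner.
-- Now let the edge before a half-edge h counterclockwise have the colour of h. The triangle on the
-- left of h then has two sides of that colour, so its third side σ (α h) has the other one and α h is
-- kept. For the next kept half-edge h′ after α h clockwise, the half-edges skipped in between share the
-- colour of h′, so either the same triangle or the hypothesis at h′ shows that α h′ is kept as well.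
-- Both half-edges of a ccw-internal edge satisfy the hypothesis.

open import Defs
open import Data.Bool using (T; if_then_else_; true; false)
open import Data.Empty using (⊥; ⊥-elim)
open import Data.Fin using (Fin; toℕ; fromℕ<) renaming (zero to fz; suc to fs)
open import Data.Fin.Permutation using (permutation)
open import Data.Fin.Properties using (_≟_; suc-injective; toℕ<n; toℕ-fromℕ<; toℕ-injective; pigeonhole; any?)
open import Data.List using (map; allFin; upTo; tabulate)
open import Data.List.Properties using (map-tabulate)
open import Data.List.Relation.Unary.All.Properties using (all⁺; all⁻; applyUpTo⁻; applyUpTo⁺₁)
open import Data.Nat using (ℕ; zero; suc; pred; _+_; _*_; _∸_; _≤_; _<_; z≤n; s≤s; _<?_)
open import Data.Nat.DivMod using (_%_; _/_; m≡m%n+[m/n]*n; m%n<n)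
open import Data.Nat.ListAction using () renaming (sum to sumˡ)
open import Data.Nat.Properties
  using (≤-refl; ≤-reflexive; ≤-trans; ≤-antisym; <⇒≤; ≮⇒≥; <⇒≤pred; <-cmp; n≤1+n; n≤0⇒n≡0;
         m≤m+n; m<m+n; m∸n≤m; m<n⇒0<n∸m; m+[n∸m]≡n; m∸n+n≡m; m+1+n≰m; ≤ᵇ⇒≤; ≤⇒≤ᵇ;
         +-comm; +-assoc; +-identityʳ; +-mono-≤; +-monoˡ-≤; +-monoʳ-≤; +-cancelʳ-≤;
         *-comm; *-assoc; *-identityˡ; *-distribˡ-+; *-monoʳ-≤; +-*-semiring; module ≤-Reasoning)
open import Data.Product using (∃-syntax; _×_; _,_; proj₁; proj₂)
open import Data.Sum using (inj₁; inj₂)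
open import Function using (_∘_; id; case_of_)
open import Relation.Binary using (tri<; tri≈; tri>)
open import Relation.Binary.PropositionalEquality
open import Relation.Nullary using (Dec; yes; no; ¬_)
open import Relation.Nullary.Decidable using (map′; _×-dec_)

open import Algebra.Properties.Semiring.Sum +-*-semiring
  using (sum; sum-syntax; ∑-distrib-+; ∑-comm; ∑-permute; *-distribˡ-sum; *-distribʳ-sum; sum-cong-≗)

-- Finite sums and indicators

𝟙 : ∀ {p} {P : Set p} → Dec P → ℕ
𝟙 (yes _) = 1
𝟙 (no _)  = 0

𝟙-yes : ∀ {p} {P : Set p} (P? : Dec P) → P → 𝟙 P? ≡ 1
𝟙-yes (yes _) _  = refl
𝟙-yes (no ¬p) p = ⊥-elim (¬p p)

𝟙-no : ∀ {p} {P : Set p} (P? : Dec P) → ¬ P → 𝟙 P? ≡ 0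
𝟙-no (yes p) ¬p = ⊥-elim (¬p p)
𝟙-no (no _)  _  = refl

sum-zero : ∀ {n} → ∑[ i < n ] 0 ≡ 0
sum-zero {zero}  = refl
sum-zero {suc n} = sum-zero {n}

sum-one : ∀ {n} → ∑[ i < n ] 1 ≡ n
sum-one {zero}  = refl
sum-one {suc n} = cong suc (sum-one {n})

sum-mono-≤ : ∀ {n} {f g : Fin n → ℕ} → (∀ i → f i ≤ g i) → sum f ≤ sum g
sum-mono-≤ {zero}  f≤g = z≤n
sum-mono-≤ {suc n} f≤g = +-mono-≤ (f≤g fz) (sum-mono-≤ (f≤g ∘ fs))

sum-allFin : ∀ {n} (f : Fin n → ℕ) → sumˡ (map f (allFin n)) ≡ sum f
sum-allFin {n} f = trans (cong sumˡ (map-tabulate {n = n} id f)) (go f)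
  where
  go : ∀ {m} (g : Fin m → ℕ) → sumˡ (tabulate g) ≡ sum g
  go {zero}  g = refl
  go {suc m} g = cong (g fz +_) (go (g ∘ fs))

sum-indicator : ∀ {n} (x : Fin n) (h : Fin n → ℕ) → ∑[ y < n ] (𝟙 (x ≟ y) * h y) ≡ h x
sum-indicator {suc n} fz h =
  trans (cong₂ _+_ (+-identityʳ (h fz)) (trans (sum-cong-≗ rest) (sum-zero {n}))) (+-identityʳ (h fz))
  where
  rest : ∀ y → 𝟙 (fz ≟ fs y) * h (fs y) ≡ 0
  rest y = cong (_* h (fs y)) (𝟙-no (fz ≟ fs y) λ ())
sum-indicator {suc n} (fs x) h =
  trans (sum-cong-≗ shift) (sum-indicator x (h ∘ fs))
  where
  shift : ∀ y → 𝟙 (fs x ≟ fs y) * h (fs y) ≡ 𝟙 (x ≟ y) * h (fs y)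
  shift y with x ≟ y
  ... | yes _ = refl
  ... | no _  = refl

sum-≡-point+rest : ∀ {n} (x : Fin n) (h : Fin n → ℕ) →
                   sum h ≡ h x + ∑[ y < n ] ((1 ∸ 𝟙 (x ≟ y)) * h y)
sum-≡-point+rest {n} x h = begin
  sum h                                                  ≡⟨ sum-cong-≗ split ⟩
  ∑[ y < n ] (𝟙 (x ≟ y) * h y + (1 ∸ 𝟙 (x ≟ y)) * h y)   ≡⟨ ∑-distrib-+ (λ y → 𝟙 (x ≟ y) * h y) rest ⟩
  ∑[ y < n ] (𝟙 (x ≟ y) * h y) + sum rest                ≡⟨ cong (_+ sum rest) (sum-indicator x h) ⟩
  h x + sum rest                                         ∎
  where
  open ≡-Reasoning
  rest : Fin n → ℕ
  rest y = (1 ∸ 𝟙 (x ≟ y)) * h y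
  split : ∀ y → h y ≡ 𝟙 (x ≟ y) * h y + (1 ∸ 𝟙 (x ≟ y)) * h y
  split y with x ≟ y
  ... | yes _ = sym (trans (+-identityʳ _) (+-identityʳ (h y)))
  ... | no _  = sym (+-identityʳ (h y))

sum-point-≤ : ∀ {n} (h : Fin n → ℕ) (x : Fin n) → h x ≤ sum h
sum-point-≤ h x = subst (h x ≤_) (sym (sum-≡-point+rest x h)) (m≤m+n (h x) _)

sum-injective-≤ : ∀ {k n} (e : Fin k → Fin n) → (∀ i j → e i ≡ e j → i ≡ j) →
                  (h : Fin n → ℕ) → sum (h ∘ e) ≤ sum h
sum-injective-≤ {zero}  e inj h = z≤n
sum-injective-≤ {suc k} e inj h = begin
  h (e fz) + sum (h ∘ e ∘ fs)   ≡⟨ cong (h (e fz) +_) (sum-cong-≗ outside-e₀) ⟩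
  h (e fz) + sum (h′ ∘ e ∘ fs)  ≤⟨ +-monoʳ-≤ (h (e fz)) (sum-injective-≤ (e ∘ fs) inj′ h′) ⟩
  h (e fz) + sum h′             ≡⟨ sym (sum-≡-point+rest (e fz) h) ⟩
  sum h                         ∎
  where
  open ≤-Reasoning
  h′ : _ → ℕ
  h′ y = (1 ∸ 𝟙 (e fz ≟ y)) * h y
  inj′ : ∀ i j → e (fs i) ≡ e (fs j) → i ≡ j
  inj′ i j eq = suc-injective (inj (fs i) (fs j) eq)
  outside-e₀ : ∀ i → h (e (fs i)) ≡ h′ (e (fs i))
  outside-e₀ i = sym (trans (cong (λ b → (1 ∸ b) * h (e (fs i))) e₀≢) (+-identityʳ _))
    where e₀≢ = 𝟙-no (e fz ≟ e (fs i)) λ eq → case inj fz (fs i) eq of λ ()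

-- Orbits of a permutation of the darts

module Orbits (M : Map) (f f⁻ : MapDefs.Dart M → MapDefs.Dart M)
              (f∘f⁻ : ∀ x → f (f⁻ x) ≡ x) (f⁻∘f : ∀ x → f⁻ (f x) ≡ x) where

  open MapDefs M using (n; Dart; OrbitLength; isOrbitMin; numOrbits)

  infix 4 _~_ _~?_

  _~_ : Dart → Dart → Set
  x ~ y = ∃[ k ] iter f k x ≡ y

  sum-∘f : ∀ h → sum (h ∘ f) ≡ sum h
  sum-∘f h = sym (∑-permute h (permutation f f⁻ f∘f⁻ f⁻∘f))

  iter-+ : ∀ j k x → iter f (j + k) x ≡ iter f j (iter f k x)
  iter-+ zero    k x = refl
  iter-+ (suc j) k x = cong f (iter-+ j k x)

  iter-comm : ∀ j k x → iter f j (iter f k x) ≡ iter f k (iter f j x)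
  iter-comm j k x = trans (sym (iter-+ j k x)) (trans (cong (λ t → iter f t x) (+-comm j k)) (iter-+ k j x))

  f-injective : ∀ {x y} → f x ≡ f y → x ≡ y
  f-injective {x} {y} eq = trans (sym (f⁻∘f x)) (trans (cong f⁻ eq) (f⁻∘f y))

  iter-injective : ∀ k {x y} → iter f k x ≡ iter f k y → x ≡ y
  iter-injective zero    eq = eq
  iter-injective (suc k) eq = iter-injective k (f-injective eq)

  iter-cancelˡ : ∀ {j k x} → j ≤ k → iter f k x ≡ iter f j x → iter f (k ∸ j) x ≡ x
  iter-cancelˡ {j} {k} {x} j≤k eq = iter-injective j (begin
    iter f j (iter f (k ∸ j) x)  ≡⟨ sym (iter-+ j (k ∸ j) x) ⟩
    iter f (j + (k ∸ j)) x       ≡⟨ cong (λ t → iter f t x) (m+[n∸m]≡n j≤k) ⟩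
    iter f k x                   ≡⟨ eq ⟩
    iter f j x                   ∎)
    where open ≡-Reasoning

  iter-period : ∀ x → ∃[ L ] 0 < L × L ≤ n × iter f L x ≡ x
  iter-period x with pigeonhole ≤-refl (λ (k : Fin (suc n)) → iter f (toℕ k) x)
  ... | i , j , i<j , eq =
    toℕ j ∸ toℕ i , m<n⇒0<n∸m i<j ,
    ≤-trans (m∸n≤m (toℕ j) (toℕ i)) (<⇒≤pred (toℕ<n j)) , iter-cancelˡ (<⇒≤ i<j) (sym eq)

  iter-multiple : ∀ {L x} → iter f L x ≡ x → ∀ q → iter f (q * L) x ≡ x
  iter-multiple per zero    = refl
  iter-multiple {L} {x} per (suc q) =
    trans (iter-+ L (q * L) x) (trans (cong (iter f L) (iter-multiple per q)) per)

  iter-mod : ∀ {L x} → iter f (suc L) x ≡ x → ∀ k → iter f k x ≡ iter f (k % suc L) x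
  iter-mod {L} {x} per k = begin
    iter f k x
      ≡⟨ cong (λ t → iter f t x) (m≡m%n+[m/n]*n k (suc L)) ⟩
    iter f (k % suc L + k / suc L * suc L) x
      ≡⟨ iter-+ (k % suc L) _ x ⟩
    iter f (k % suc L) (iter f (k / suc L * suc L) x)
      ≡⟨ cong (iter f (k % suc L)) (iter-multiple per (k / suc L)) ⟩
    iter f (k % suc L) x ∎
    where open ≡-Reasoning

  ~-within-period : ∀ {L x y} → 0 < L → iter f L x ≡ x → x ~ y → ∃[ k ] k < L × iter f k x ≡ y
  ~-within-period {suc L} _ per (k , eq) = k % suc L , m%n<n k (suc L) , trans (sym (iter-mod per k)) eq

  ~-refl : ∀ {x} → x ~ x
  ~-refl = 0 , refl

  ~-step : ∀ x → x ~ f x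
  ~-step x = 1 , refl

  ~-trans : ∀ {x y z} → x ~ y → y ~ z → x ~ z
  ~-trans {x} (j , refl) (k , refl) = k + j , iter-+ k j x

  ~-sym : ∀ {x y} → x ~ y → y ~ x
  ~-sym {x} x~y with iter-period x
  ... | L , 0<L , _ , per with ~-within-period 0<L per x~y
  ...   | k , k<L , refl = L ∸ k , trans (sym (iter-+ (L ∸ k) k x))
                                    (trans (cong (λ t → iter f t x) (m∸n+n≡m (<⇒≤ k<L))) per)

  ~-bounded : ∀ {x y} → x ~ y → ∃[ k ] k < n × iter f k x ≡ y
  ~-bounded {x} x~y with iter-period x
  ... | L , 0<L , L≤n , per with ~-within-period 0<L per x~y
  ...   | k , k<L , eq = k , ≤-trans k<L L≤n , eq

  opaque
    _~?_ : ∀ x y → Dec (x ~ y)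
    x ~? y = map′ (λ (k , eq) → toℕ k , eq) from (any? λ (k : Fin n) → iter f (toℕ k) x ≟ y)
      where
      from : x ~ y → ∃[ k ] iter f (toℕ {n} k) x ≡ y
      from x~y with ~-bounded x~y
      ... | k , k<n , eq = fromℕ< k<n , trans (cong (λ t → iter f t x) (toℕ-fromℕ< k<n)) eq

  iter-fixed-transport : ∀ j {x y} → x ~ y → iter f j x ≡ x → iter f j y ≡ y
  iter-fixed-transport j {x} (k , refl) fix = trans (iter-comm j k x) (cong (iter f k) fix)

  orbitLength-transport : ∀ {x y L} → x ~ y → OrbitLength f x L → OrbitLength f y L
  orbitLength-transport {L = L} x~y (0<L , per , exact) =
    0<L , iter-fixed-transport L x~y per ,
    λ j 0<j j<L fix → exact j 0<j j<L (iter-fixed-transport j (~-sym x~y) fix)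

  iterates-distinct : ∀ {L x} → (∀ j → 0 < j → j < L → iter f j x ≢ x) →
                      ∀ (i j : Fin L) → toℕ i < toℕ j → iter f (toℕ j) x ≢ iter f (toℕ i) x
  iterates-distinct exact i j i<j eq = exact (toℕ j ∸ toℕ i) (m<n⇒0<n∸m i<j)
    (≤-trans (s≤s (m∸n≤m (toℕ j) (toℕ i))) (toℕ<n j)) (iter-cancelˡ (<⇒≤ i<j) eq)

  iterates-injective : ∀ {L x} → (∀ j → 0 < j → j < L → iter f j x ≢ x) →
                       ∀ (i j : Fin L) → iter f (toℕ i) x ≡ iter f (toℕ j) x → i ≡ j
  iterates-injective exact i j eq with <-cmp (toℕ i) (toℕ j)
  ... | tri< i<j _ _ = ⊥-elim (iterates-distinct exact i j i<j (sym eq))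
  ... | tri≈ _ i≡j _ = toℕ-injective i≡j
  ... | tri> _ _ j<i = ⊥-elim (iterates-distinct exact j i j<i eq)

  IsOrbitMin : Dart → Set
  IsOrbitMin m = ∀ y → m ~ y → toℕ m ≤ toℕ y

  isOrbitMin-sound : ∀ {m} → T (isOrbitMin f m) → IsOrbitMin m
  isOrbitMin-sound {m} t y m~y with ~-bounded m~y
  ... | k , k<n , refl = ≤ᵇ⇒≤ _ _ (applyUpTo⁻ id n (all⁺ _ (upTo n) t) k<n)

  isOrbitMin-complete : ∀ {m} → IsOrbitMin m → T (isOrbitMin f m)
  isOrbitMin-complete min = all⁻ _ (applyUpTo⁺₁ id n λ {k} _ → ≤⇒≤ᵇ (min _ (k , refl)))

  orbitMin-unique : ∀ {m₁ m₂} → IsOrbitMin m₁ → IsOrbitMin m₂ → m₁ ~ m₂ → m₁ ≡ m₂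
  orbitMin-unique min₁ min₂ m₁~m₂ = toℕ-injective (≤-antisym (min₁ _ m₁~m₂) (min₂ _ (~-sym m₁~m₂)))

  orbitMin-below : ∀ x fuel y → x ~ y → toℕ y < fuel → ∃[ m ] x ~ m × (∀ z → x ~ z → toℕ m ≤ toℕ z)
  orbitMin-below x (suc fuel) y x~y (s≤s y≤fuel) with any? (λ z → (x ~? z) ×-dec (toℕ z <? toℕ y))
  ... | yes (z , x~z , z<y) = orbitMin-below x fuel z x~z (≤-trans z<y y≤fuel)
  ... | no none             = y , x~y , λ z x~z → ≮⇒≥ λ z<y → none (z , x~z , z<y)

  orbitMin-exists : ∀ x → ∃[ m ] x ~ m × IsOrbitMin m
  orbitMin-exists x with orbitMin-below x (suc (toℕ x)) x ~-refl ≤-refl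
  ... | m , x~m , below = m , x~m , λ z m~z → below z (~-trans x~m m~z)

  rep : Dart → ℕ
  rep m = if isOrbitMin f m then 1 else 0

  numOrbits≡∑rep : numOrbits f ≡ sum rep
  numOrbits≡∑rep = sum-allFin rep

  ∑ᵒ : (Dart → ℕ) → ℕ
  ∑ᵒ a = ∑[ m < n ] (rep m * a m)

  ∑ᵒ-orbitOf : ∀ y → ∑ᵒ (λ m → 𝟙 (m ~? y)) ≡ 1
  ∑ᵒ-orbitOf y with orbitMin-exists y
  ... | p , y~p , min-p = trans (sum-cong-≗ only-p) (sum-indicator p λ _ → 1)
    where
    only-p : ∀ m → rep m * 𝟙 (m ~? y) ≡ 𝟙 (p ≟ m) * 1
    only-p m with isOrbitMin f m in eq | m ~? y | p ≟ m
    ... | true  | yes m~y | yes _    = refl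
    ... | true  | yes m~y | no p≢m   =
      ⊥-elim (p≢m (orbitMin-unique min-p (isOrbitMin-sound (subst T (sym eq) _))
                                   (~-trans (~-sym y~p) (~-sym m~y))))
    ... | true  | no ¬m~y | yes refl = ⊥-elim (¬m~y (~-sym y~p))
    ... | true  | no _    | no _     = refl
    ... | false | _       | yes refl = ⊥-elim (subst T eq (isOrbitMin-complete min-p))
    ... | false | _       | no _     = refl

  ∑ᵒ-mono-≤ : ∀ {a b} → (∀ m → a m ≤ b m) → ∑ᵒ a ≤ ∑ᵒ b
  ∑ᵒ-mono-≤ a≤b = sum-mono-≤ λ m → *-monoʳ-≤ (rep m) (a≤b m)

  ∑ᵒ-+ : ∀ a b → ∑ᵒ (λ m → a m + b m) ≡ ∑ᵒ a + ∑ᵒ b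
  ∑ᵒ-+ a b = trans (sum-cong-≗ λ m → *-distribˡ-+ (rep m) (a m) (b m))
                   (∑-distrib-+ (λ m → rep m * a m) (λ m → rep m * b m))

  ∑ᵒ-const : ∀ c → ∑ᵒ (λ _ → c) ≡ c * numOrbits f
  ∑ᵒ-const c = begin
    ∑[ m < n ] (rep m * c)  ≡⟨ sum-cong-≗ (λ m → *-comm (rep m) c) ⟩
    ∑[ m < n ] (c * rep m)  ≡⟨ sym (*-distribˡ-sum c rep) ⟩
    c * sum rep             ≡⟨ cong (c *_) (sym numOrbits≡∑rep) ⟩
    c * numOrbits f         ∎
    where open ≡-Reasoning

  orbitSum : (Dart → ℕ) → Dart → ℕ
  orbitSum h m = ∑[ y < n ] (𝟙 (m ~? y) * h y)

  ∑ᵒ-orbitSum : ∀ h → ∑ᵒ (orbitSum h) ≡ sum h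
  ∑ᵒ-orbitSum h = begin
    ∑[ m < n ] (rep m * ∑[ y < n ] (𝟙 (m ~? y) * h y))
      ≡⟨ sum-cong-≗ (λ m → *-distribˡ-sum (rep m) λ y → 𝟙 (m ~? y) * h y) ⟩
    ∑[ m < n ] ∑[ y < n ] (rep m * (𝟙 (m ~? y) * h y))
      ≡⟨ ∑-comm (λ m y → rep m * (𝟙 (m ~? y) * h y)) ⟩
    ∑[ y < n ] ∑[ m < n ] (rep m * (𝟙 (m ~? y) * h y))
      ≡⟨ sum-cong-≗ (λ y → sum-cong-≗ λ m → sym (*-assoc (rep m) _ (h y))) ⟩
    ∑[ y < n ] ∑[ m < n ] (rep m * 𝟙 (m ~? y) * h y)
      ≡⟨ sum-cong-≗ (λ y → sym (*-distribʳ-sum (h y) λ m → rep m * 𝟙 (m ~? y))) ⟩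
    ∑[ y < n ] (∑ᵒ (λ m → 𝟙 (m ~? y)) * h y)
      ≡⟨ sum-cong-≗ (λ y → cong (_* h y) (∑ᵒ-orbitOf y)) ⟩
    ∑[ y < n ] (1 * h y)
      ≡⟨ sum-cong-≗ (λ y → *-identityˡ (h y)) ⟩
    sum h ∎
    where open ≡-Reasoning

  ∑ᵒ-meeting-≤ : ∀ {k} (p : Fin k → Dart) → ∑ᵒ (λ m → 𝟙 (any? λ i → p i ~? m)) ≤ k
  ∑ᵒ-meeting-≤ {k} p = begin
    ∑ᵒ (λ m → 𝟙 (any? λ i → p i ~? m))
      ≤⟨ ∑ᵒ-mono-≤ hit ⟩
    ∑ᵒ (λ m → ∑[ i < k ] 𝟙 (m ~? p i))
      ≡⟨ sum-cong-≗ (λ m → *-distribˡ-sum (rep m) λ i → 𝟙 (m ~? p i)) ⟩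
    ∑[ m < n ] ∑[ i < k ] (rep m * 𝟙 (m ~? p i))
      ≡⟨ ∑-comm (λ m i → rep m * 𝟙 (m ~? p i)) ⟩
    ∑[ i < k ] ∑ᵒ (λ m → 𝟙 (m ~? p i))
      ≡⟨ sum-cong-≗ (∑ᵒ-orbitOf ∘ p) ⟩
    ∑[ i < k ] 1
      ≡⟨ sum-one ⟩
    k ∎
    where
    open ≤-Reasoning
    hit : ∀ m → 𝟙 (any? λ i → p i ~? m) ≤ ∑[ i < k ] 𝟙 (m ~? p i)
    hit m with any? (λ i → p i ~? m)
    ... | no _          = z≤n
    ... | yes (i , p~m) = subst (_≤ _) (𝟙-yes (m ~? p i) (~-sym p~m)) (sum-point-≤ (λ i → 𝟙 (m ~? p i)) i)

  orbitSum-≤-iterates : ∀ {L m} h → 0 < L → iter f L m ≡ m →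
                        orbitSum h m ≤ ∑[ k < L ] h (iter f (toℕ k) m)
  orbitSum-≤-iterates {L} {m} h 0<L per = begin
    ∑[ y < n ] (𝟙 (m ~? y) * h y)                 ≤⟨ sum-mono-≤ hit ⟩
    ∑[ y < n ] ∑[ k < L ] (𝟙 (x k ≟ y) * h y)     ≡⟨ ∑-comm (λ y k → 𝟙 (x k ≟ y) * h y) ⟩
    ∑[ k < L ] ∑[ y < n ] (𝟙 (x k ≟ y) * h y)     ≡⟨ sum-cong-≗ (λ k → sum-indicator (x k) h) ⟩
    ∑[ k < L ] h (x k)                            ∎
    where
    open ≤-Reasoning
    x : Fin L → Dart
    x k = iter f (toℕ k) m
    hit : ∀ y → 𝟙 (m ~? y) * h y ≤ ∑[ k < L ] (𝟙 (x k ≟ y) * h y)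
    hit y with m ~? y
    ... | no _    = z≤n
    ... | yes m~y with ~-within-period 0<L per m~y
    ...   | k , k<L , eq =
      subst (λ t → t * h y ≤ _) (𝟙-yes (x k′ ≟ y) x-k′) (sum-point-≤ (λ k → 𝟙 (x k ≟ y) * h y) k′)
      where
      k′ = fromℕ< k<L
      x-k′ : x k′ ≡ y
      x-k′ = trans (cong (λ t → iter f t m) (toℕ-fromℕ< k<L)) eq

  ∑-≤-orbitSum : ∀ {k m} h (e : Fin k → Dart) → (∀ i j → e i ≡ e j → i ≡ j) → (∀ i → m ~ e i) →
                 sum (h ∘ e) ≤ orbitSum h m
  ∑-≤-orbitSum {m = m} h e inj m~e =
    subst (_≤ _) (sum-cong-≗ λ i → trans (cong (_* h (e i)) (𝟙-yes (m ~? e i) (m~e i))) (*-identityˡ _))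
          (sum-injective-≤ e inj λ y → 𝟙 (m ~? y) * h y)

  orbitSum-point-≤ : ∀ {m y} h → m ~ y → h y ≤ orbitSum h m
  orbitSum-point-≤ {m} {y} h m~y =
    subst (_≤ orbitSum h m) (trans (cong (_* h y) (𝟙-yes (m ~? y) m~y)) (*-identityˡ (h y)))
          (sum-point-≤ (λ z → 𝟙 (m ~? z) * h z) y)

  orbitSum-~ : ∀ {x y} h → x ~ y → orbitSum h x ≡ orbitSum h y
  orbitSum-~ {x} {y} h x~y = sum-cong-≗ λ z → cong (_* h z) (same z)
    where
    same : ∀ z → 𝟙 (x ~? z) ≡ 𝟙 (y ~? z)
    same z with x ~? z | y ~? z
    ... | yes _   | yes _   = refl
    ... | no _    | no _    = refl
    ... | yes x~z | no ¬y~z = ⊥-elim (¬y~z (~-trans (~-sym x~y) x~z))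
    ... | no ¬x~z | yes y~z = ⊥-elim (¬x~z (~-trans x~y y~z))

-- Faces and the outer face

module Faces (M : Map) where
  open MapDefs M public

  φ⁻ : Dart → Dart
  φ⁻ x = α (σ⁻ x)

  φ∘φ⁻ : ∀ x → φ (φ⁻ x) ≡ x
  φ∘φ⁻ x = trans (cong σ (α-invol (σ⁻ x))) (σσ⁻ x)

  φ⁻∘φ : ∀ x → φ⁻ (φ x) ≡ x
  φ⁻∘φ x = trans (cong α (σ⁻σ (α x))) (α-invol x)

  module V = Orbits M σ σ⁻ σσ⁻ σ⁻σ
  module F = Orbits M φ φ⁻ φ∘φ⁻ φ⁻∘φ

  σ-via-φ : ∀ x → σ x ≡ φ (α x)
  σ-via-φ x = cong σ (sym (α-invol x))

  σ⁻-φ : ∀ x → σ⁻ (φ x) ≡ α x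
  σ⁻-φ x = σ⁻σ (α x)

  no-loop-of-α≡φ² : Simple → ∀ x → α x ≢ φ (φ x)
  no-loop-of-α≡φ² (no-loop , _) x αx≡φ²x =
    no-loop (α (φ x)) (subst (SameVertex (α (φ x))) (sym (α-invol (φ x))) (2 , cong σ (sym αx≡φ²x)))

module OuterFace (M : Map) (o : MapDefs.Dart M) (IT : MapDefs.Outer.IrreducibleTriangulation M o) where
  open Faces M public
  open Outer o public
  open IrreducibleTriangulation IT public

  outer-period : ∀ {z} → SameFace o z → iter φ 4 z ≡ z
  outer-period o~z = F.iter-fixed-transport 4 o~z (proj₁ (proj₂ outerQuad))

  inner-period : ∀ {z} → ¬ SameFace o z → iter φ 3 z ≡ z
  inner-period z-inner = proj₁ (proj₂ (innerTri _ z-inner))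

  outer-φ : ∀ {z} → SameFace o z → SameFace o (φ z)
  outer-φ o~z = F.~-trans o~z (F.~-step _)

  a-outer : ∀ i → SameFace o (a i)
  a-outer i = toℕ i , refl

  outer-index : ∀ {z} → SameFace o z → ∃[ i ] z ≡ a i
  outer-index o~z with F.~-within-period {4} (s≤s z≤n) (outer-period F.~-refl) o~z
  ... | k , k<4 , eq = fromℕ< k<4 , trans (sym eq) (cong (λ t → iter φ t o) (sym (toℕ-fromℕ< k<4)))

  a-injective : ∀ i j → a i ≡ a j → i ≡ j
  a-injective = F.iterates-injective (proj₂ (proj₂ outerQuad))

  φ-a : ∀ i → φ (a i) ≡ a (nxt4 i)
  φ-a fz                = refl
  φ-a (fs fz)           = refl
  φ-a (fs (fs fz))      = refl
  φ-a (fs (fs (fs fz))) = outer-period F.~-refl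

  module _ (dI : Dart) (dI-inner : ¬ SameFace o dI) where

    -- If α q ≡ φ q, the face of q is closed under α and σ (it is the face of a path with two edges),
    -- so by connectivity it would contain the inner dart dI.
    outer-twin-≢-φ : ∀ {q} → SameFace o q → α q ≢ φ q
    outer-twin-≢-φ {q} o~q αq≡φq = dI-inner (F.~-trans o~q (closed (proj₁ planar q dI) F.~-refl))
      where
      r = φ (φ q)
      s = φ r
      σq≡r : σ q ≡ r
      σq≡r = trans (σ-via-φ q) (cong φ αq≡φq)
      αs≡r : α s ≡ r
      αs≡r = proj₂ simple (α s) r (2 , trans (cong σ (outer-period o~q)) σq≡r)
                                  (subst (λ t → SameVertex t (α r)) (sym (α-invol s)) (V.~-sym (1 , refl)))
      α-closed : ∀ {z} → F._~_ q z → F._~_ q (α z)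
      α-closed q~z with F.~-within-period {4} (s≤s z≤n) (outer-period o~q) q~z
      ... | 0 , _ , refl = 1 , sym αq≡φq
      ... | 1 , _ , refl = 0 , sym (trans (cong α (sym αq≡φq)) (α-invol q))
      ... | 2 , _ , refl = 3 , sym (trans (cong α (sym αs≡r)) (α-invol s))
      ... | 3 , _ , refl = 2 , sym αs≡r
      ... | suc (suc (suc (suc _))) , s≤s (s≤s (s≤s (s≤s ()))) , _
      closed : ∀ {x z} → Reach x z → F._~_ q x → F._~_ q z
      closed here        q~x = q~x
      closed (viaα x→z)  q~x = closed x→z (α-closed q~x)
      closed (viaσ {x} x→z) q~x =
        closed x→z (subst (F._~_ q) (sym (σ-via-φ x)) (F.~-trans (α-closed q~x) (F.~-step _)))

    outer-twin-inner : ∀ {p} → SameFace o p → ¬ SameFace o (α p)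
    outer-twin-inner {p} o~p o~αp
      with F.~-within-period {4} (s≤s z≤n) (outer-period o~p) (F.~-trans (F.~-sym o~p) o~αp)
    ... | 0 , _ , eq = α-nofix p (sym eq)
    ... | 1 , _ , eq = outer-twin-≢-φ o~p (sym eq)
    ... | 2 , _ , eq = no-loop-of-α≡φ² simple p (sym eq)
    ... | 3 , _ , eq = outer-twin-≢-φ o~αp (trans (α-invol p) (sym (trans (cong φ (sym eq)) (outer-period o~p))))
    ... | suc (suc (suc (suc _))) , s≤s (s≤s (s≤s (s≤s ()))) , _

-- Colours, corners and Euler's formula

flip-involutive : ∀ c → flip (flip c) ≡ c
flip-involutive red  = refl
flip-involutive blue = refl

flip-≢ : ∀ c → flip c ≢ c
flip-≢ red  ()
flip-≢ blue ()

colour-stable : ∀ {c c′ : Color} → ¬ c ≢ c′ → c ≡ c′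
colour-stable {red}  {red}  _   = refl
colour-stable {red}  {blue} ¬≢ = ⊥-elim (¬≢ λ ())
colour-stable {blue} {red}  ¬≢ = ⊥-elim (¬≢ λ ())
colour-stable {blue} {blue} _   = refl

switch : Color → Color → ℕ
switch blue red  = 1
switch blue blue = 0
switch red  _    = 0

switch-refl : ∀ c → switch c c ≡ 0
switch-refl red  = refl
switch-refl blue = refl

switch-triangle : ∀ x y z → switch x y + (switch y z + (switch z x + 0)) ≤ 1
switch-triangle red  red  red  = z≤n
switch-triangle red  red  blue = s≤s z≤n
switch-triangle red  blue red  = s≤s z≤n
switch-triangle red  blue blue = s≤s z≤n
switch-triangle blue red  red  = s≤s z≤n
switch-triangle blue red  blue = s≤s z≤n
switch-triangle blue blue red  = s≤s z≤n
switch-triangle blue blue blue = z≤n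

switch-alternating : ∀ c → let c′ = flip c ; c″ = flip c′ ; c‴ = flip c″ in
                     switch c c′ + (switch c′ c″ + (switch c″ c‴ + (switch c‴ c + 0))) ≤ 2
switch-alternating red  = s≤s (s≤s z≤n)
switch-alternating blue = s≤s (s≤s z≤n)

euler-contradiction : ∀ {v f x n} → 2 * v ≤ x + 4 → x ≤ f → 3 * f + 1 ≤ n → 2 * (v + f) ≡ n + 4 → ⊥
euler-contradiction {v} {f} {x} {n} vertices corners darts euler =
  m+1+n≰m (3 * f) (≤-trans darts (+-cancelʳ-≤ 4 n (3 * f) (begin
    n + 4              ≡⟨ sym euler ⟩
    2 * (v + f)        ≡⟨ *-distribˡ-+ 2 v f ⟩
    2 * v + 2 * f      ≤⟨ +-monoˡ-≤ (2 * f) (≤-trans vertices (+-monoˡ-≤ 4 corners)) ⟩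
    f + 4 + 2 * f      ≡⟨ +-assoc f 4 (2 * f) ⟩
    f + (4 + 2 * f)    ≡⟨ cong (f +_) (+-comm 4 (2 * f)) ⟩
    f + (2 * f + 4)    ≡⟨ sym (+-assoc f (2 * f) 4) ⟩
    3 * f + 4          ∎)))
  where open ≤-Reasoning

module Colouring (M : Map) (o : MapDefs.Dart M) (IT : MapDefs.Outer.IrreducibleTriangulation M o)
                 (col : MapDefs.Dart M → Color) (TR : MapDefs.Outer.Transversal M o col)
                 (dI : MapDefs.Dart M) (dI-inner : ¬ MapDefs.SameFace M o dI) where
  open OuterFace M o IT public
  open Transversal TR public

  c₀ : Color
  c₀ = proj₁ outerVertices

  aColour : Fin 4 → Color
  aColour fz                = c₀
  aColour (fs fz)           = flip c₀
  aColour (fs (fs fz))      = c₀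
  aColour (fs (fs (fs fz))) = flip c₀

  aColour-nxt4 : ∀ i → aColour (nxt4 i) ≡ flip (aColour i)
  aColour-nxt4 fz                = refl
  aColour-nxt4 (fs fz)           = sym (flip-involutive c₀)
  aColour-nxt4 (fs (fs fz))      = refl
  aColour-nxt4 (fs (fs (fs fz))) = sym (flip-involutive c₀)

  col-at-a : ∀ i {z} → InnerEdge z → SameVertex (a i) z → col z ≡ aColour i
  col-at-a fz                z-inner a~z = proj₁ (proj₂ outerVertices _ z-inner) (inj₁ a~z)
  col-at-a (fs fz)           z-inner a~z = proj₂ (proj₂ outerVertices _ z-inner) (inj₁ a~z)
  col-at-a (fs (fs fz))      z-inner a~z = proj₁ (proj₂ outerVertices _ z-inner) (inj₂ a~z)
  col-at-a (fs (fs (fs fz))) z-inner a~z = proj₂ (proj₂ outerVertices _ z-inner) (inj₂ a~z)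

  outerColour : ∀ {z} → SameFace o z → Color
  outerColour o~z = aColour (proj₁ (outer-index o~z))

  outerColour-a : ∀ i (o~a : SameFace o (a i)) → outerColour o~a ≡ aColour i
  outerColour-a i o~a = cong aColour (a-injective (proj₁ (outer-index o~a)) i (sym (proj₂ (outer-index o~a))))

  outerColour-irrelevant : ∀ {z z′} → z ≡ z′ → (o~z : SameFace o z) (o~z′ : SameFace o z′) →
                           outerColour o~z ≡ outerColour o~z′
  outerColour-irrelevant refl o~z o~z′ with outer-index o~z
  ... | i , refl = trans (outerColour-a i o~z) (sym (outerColour-a i o~z′))

  -- The outer edge from a i to a (i+1) gets the colour of the inner edges at a i, so the colours
  -- alternate along the outer face and the two outer edges at an outer vertex differ in colour.
  colourBy : (z : Dart) → Dec (SameFace o z) → Dec (SameFace o (α z)) → Color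
  colourBy z (yes o~z) _          = outerColour o~z
  colourBy z (no _)    (yes o~αz) = outerColour o~αz
  colourBy z (no _)    (no _)     = col z

  col′ : Dart → Color
  col′ z = colourBy z (o F.~? z) (o F.~? α z)

  col′-outer : ∀ {z} (o~z : SameFace o z) → col′ z ≡ outerColour o~z
  col′-outer {z} o~z with o F.~? z
  ... | yes o~z′ = outerColour-irrelevant refl o~z′ o~z
  ... | no ¬o~z  = ⊥-elim (¬o~z o~z)

  col′-inner : ∀ {z} → InnerEdge z → col′ z ≡ col z
  col′-inner {z} (¬o~z , ¬o~αz) with o F.~? z | o F.~? α z
  ... | yes o~z | _        = ⊥-elim (¬o~z o~z)
  ... | no _    | yes o~αz = ⊥-elim (¬o~αz o~αz)
  ... | no _    | no _     = refl

  col′-α : ∀ z → col′ (α z) ≡ col′ z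
  col′-α z with o F.~? z | o F.~? α z | o F.~? α (α z)
  ... | yes o~z | yes o~αz | _         = ⊥-elim (outer-twin-inner dI dI-inner o~z o~αz)
  ... | yes o~z | no _     | yes o~ααz = outerColour-irrelevant (α-invol z) o~ααz o~z
  ... | yes o~z | no _     | no ¬o~ααz = ⊥-elim (¬o~ααz (subst (SameFace o) (sym (α-invol z)) o~z))
  ... | no _    | yes _    | _         = refl
  ... | no ¬o~z | no _     | yes o~ααz = ⊥-elim (¬o~z (subst (SameFace o) (α-invol z) o~ααz))
  ... | no ¬o~z | no ¬o~αz | no _      = edgeColour z (¬o~z , ¬o~αz)

  col′-a : ∀ i → col′ (a i) ≡ aColour i
  col′-a i = trans (col′-outer (a-outer i)) (outerColour-a i (a-outer i))

  col′-φ-outer : ∀ {z} → SameFace o z → col′ (φ z) ≡ flip (col′ z)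
  col′-φ-outer o~z with outer-index o~z
  ... | i , refl =
    trans (cong col′ (φ-a i)) (trans (col′-a (nxt4 i)) (trans (aColour-nxt4 i) (cong flip (sym (col′-a i)))))

  corner : Dart → ℕ
  corner z = switch (col′ (σ⁻ z)) (col′ z)

  corner-φ : ∀ w → corner (φ w) ≡ switch (col′ w) (col′ (φ w))
  corner-φ w = cong (λ c → switch c (col′ (φ w))) (trans (cong col′ (σ⁻-φ w)) (col′-α w))

  corner-at : ∀ {x k} → 0 < k → col′ (iter σ (pred k) x) ≡ blue → col′ (iter σ k x) ≡ red →
              corner (iter σ k x) ≡ 1
  corner-at {k = suc k} _ blue≡ red≡ = cong₂ switch (trans (cong col′ (σ⁻σ _)) blue≡) red≡

  walk-to-red : ∀ k {y} → col′ y ≡ blue → col′ (iter σ k y) ≡ red → ∃[ j ] corner (iter σ j y) ≡ 1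
  walk-to-red zero    blue≡ red≡ with () ← trans (sym blue≡) red≡
  walk-to-red (suc k) {y} blue≡ red≡ with col′ (iter σ k y) in eq
  ... | red  = walk-to-red k blue≡ eq
  ... | blue = suc k , corner-at {k = suc k} (s≤s z≤n) eq red≡

  corner-between : ∀ {y y′} → SameVertex y y′ → col′ y ≢ col′ y′ → ∃[ z ] SameVertex y z × corner z ≡ 1
  corner-between {y} {y′} y~y′ ≢ with col′ y in eq | col′ y′ in eq′
  ... | red  | red  = ⊥-elim (≢ refl)
  ... | blue | blue = ⊥-elim (≢ refl)
  ... | blue | red with y~y′
  ...   | k , refl with walk-to-red k eq eq′
  ...     | j , c = iter σ j y , (j , refl) , c
  corner-between {y} {y′} y~y′ ≢ | red | blue with V.~-sym y~y′
  ...   | k , refl with walk-to-red k eq′ eq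
  ...     | j , c = iter σ j y′ , V.~-trans y~y′ (j , refl) , c

  outer? : ∀ z → Dec (OuterVertex z)
  outer? z = any? λ i → a i V.~? z

  inner-vertex-edge : ∀ {z} → ¬ OuterVertex z → InnerEdge z
  inner-vertex-edge {z} z-inner = z-not-outer , αz-not-outer
    where
    z-not-outer : ¬ SameFace o z
    z-not-outer o~z with outer-index o~z
    ... | i , z≡a = z-inner (i , 0 , sym z≡a)
    αz-not-outer : ¬ SameFace o (α z)
    αz-not-outer o~αz with outer-index (outer-φ o~αz)
    ... | i , φαz≡a = z-inner (i , V.~-sym (1 , trans (σ-via-φ z) φαz≡a))

  inner-around : ∀ {m z} → ¬ OuterVertex m → SameVertex m z → InnerEdge z
  inner-around m-inner m~z = inner-vertex-edge λ (i , a~z) → m-inner (i , V.~-trans a~z (V.~-sym m~z))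

  inner-vertex-corners : ∀ m → ¬ OuterVertex m → 2 ≤ V.orbitSum corner m
  inner-vertex-corners m m-inner with innerVertex m m-inner
  ... | d₀ , r₁ , b₁ , r₂ , b₂ , m~d₀ , (0<L , per , exact) , 0<r₁ , 0<b₁ , 0<r₂ , 0<b₂ , I₁ , I₂ , I₃ , I₄ =
    subst (_≤ V.orbitSum corner m) (cong₂ _+_ corner-d₀ (cong (_+ 0) corner-p₁))
          (V.∑-≤-orbitSum corner e e-injective m~e)
    where
    -- d₀ and σ^P d₀ start the two red intervals.
    P = r₁ + b₁
    L = P + r₂ + b₂
    pred< : ∀ {k} → 0 < k → pred k < k
    pred< (s≤s z≤n) = ≤-refl
    col′≡col : ∀ k → col′ (iter σ k d₀) ≡ col (iter σ k d₀)
    col′≡col k = col′-inner (inner-around m-inner (V.~-trans m~d₀ (k , refl)))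
    corner-d₀ : corner d₀ ≡ 1
    corner-d₀ = subst (λ z → corner z ≡ 1) per (corner-at 0<L
      (trans (col′≡col (pred L)) (I₄ (pred L) (<⇒≤pred (m<m+n (P + r₂) 0<b₂)) (pred< 0<L)))
      (trans (cong col′ per) (trans (col′≡col 0) (I₁ 0 0<r₁))))
    0<P : 0 < P
    0<P = ≤-trans 0<r₁ (m≤m+n r₁ b₁)
    corner-p₁ : corner (iter σ P d₀) ≡ 1
    corner-p₁ = corner-at 0<P
      (trans (col′≡col (pred P)) (I₂ (pred P) (<⇒≤pred (m<m+n r₁ 0<b₁)) (pred< 0<P)))
      (trans (col′≡col P) (I₃ P ≤-refl (m<m+n P 0<r₂)))
    e : Fin 2 → Dart
    e fz      = d₀
    e (fs fz) = iter σ P d₀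
    P<L : P < L
    P<L = ≤-trans (m<m+n P 0<r₂) (m≤m+n (P + r₂) b₂)
    e-injective : ∀ i j → e i ≡ e j → i ≡ j
    e-injective fz      fz      _  = refl
    e-injective fz      (fs fz) eq = ⊥-elim (exact P 0<P P<L (sym eq))
    e-injective (fs fz) fz      eq = ⊥-elim (exact P 0<P P<L eq)
    e-injective (fs fz) (fs fz) _  = refl
    m~e : ∀ i → SameVertex m (e i)
    m~e fz      = m~d₀
    m~e (fs fz) = V.~-trans m~d₀ (P , refl)

  outer-vertex-colours-differ : ∀ i → col′ (σ⁻ (a i)) ≢ col′ (a i)
  outer-vertex-colours-differ i eq = flip-≢ _ (sym (begin
    col′ (σ⁻ x)        ≡⟨ eq ⟩
    col′ x             ≡⟨ cong col′ (sym (φ∘φ⁻ x)) ⟩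
    col′ (φ (φ⁻ x))    ≡⟨ col′-φ-outer (F.~-trans (a-outer i) (F.~-sym (1 , φ∘φ⁻ x))) ⟩
    flip (col′ (φ⁻ x)) ≡⟨ cong flip (col′-α (σ⁻ x)) ⟩
    flip (col′ (σ⁻ x)) ∎))
    where
    open ≡-Reasoning
    x = a i

  corner-≤-orbitSum : ∀ {m x} → SameVertex m x → ∃[ z ] SameVertex x z × corner z ≡ 1 → 1 ≤ V.orbitSum corner m
  corner-≤-orbitSum {m} m~x (z , x~z , c) =
    subst (_≤ V.orbitSum corner m) c (V.orbitSum-point-≤ corner (V.~-trans m~x x~z))

  vertex-corners : ∀ m → 2 ≤ V.orbitSum corner m + 𝟙 (outer? m)
  vertex-corners m = by-position (outer? m)
    where
    by-position : (m-outer? : Dec (OuterVertex m)) → 2 ≤ V.orbitSum corner m + 𝟙 m-outer?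
    by-position (yes (i , a~m)) = +-monoˡ-≤ 1 (corner-≤-orbitSum m~σ⁻a
      (corner-between (1 , σσ⁻ (a i)) (outer-vertex-colours-differ i)))
      where
      m~σ⁻a : SameVertex m (σ⁻ (a i))
      m~σ⁻a = V.~-trans (V.~-sym a~m) (V.~-sym (1 , σσ⁻ (a i)))
    by-position (no m-inner) = subst (2 ≤_) (sym (+-identityʳ _)) (inner-vertex-corners m m-inner)

  faceCorner : Dart → ℕ
  faceCorner w = corner (φ w)

  faceCorner-colours : ∀ {w x y} → col′ w ≡ x → col′ (φ w) ≡ y → faceCorner w ≡ switch x y
  faceCorner-colours {w} w≡x φw≡y = trans (corner-φ w) (cong₂ switch w≡x φw≡y)

  triangle-corners : ∀ {m} → ¬ SameFace o m → F.orbitSum faceCorner m ≤ 1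
  triangle-corners {m} m-inner = begin
    F.orbitSum faceCorner m
      ≤⟨ F.orbitSum-≤-iterates {3} faceCorner (s≤s z≤n) (inner-period m-inner) ⟩
    faceCorner m + (faceCorner (φ m) + (faceCorner (φ (φ m)) + 0))
      ≡⟨ cong₂ _+_ (faceCorner-colours refl refl) (cong₂ _+_ (faceCorner-colours refl refl)
           (cong (_+ 0) (faceCorner-colours refl (cong col′ (inner-period m-inner))))) ⟩
    switch c₁ c₂ + (switch c₂ c₃ + (switch c₃ c₁ + 0))
      ≤⟨ switch-triangle c₁ c₂ c₃ ⟩
    1 ∎
    where
    open ≤-Reasoning
    c₁ = col′ m
    c₂ = col′ (φ m)
    c₃ = col′ (φ (φ m))

  Monochromatic : Dart → Set
  Monochromatic w = col′ w ≡ col′ (φ w) × col′ (φ w) ≡ col′ (φ (φ w))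

  monochromatic-corners : ∀ {w} → ¬ SameFace o w → Monochromatic w → F.orbitSum faceCorner w ≡ 0
  monochromatic-corners {w} w-inner (e₁ , e₂) = n≤0⇒n≡0 (begin
    F.orbitSum faceCorner w
      ≤⟨ F.orbitSum-≤-iterates {3} faceCorner (s≤s z≤n) (inner-period w-inner) ⟩
    faceCorner w + (faceCorner (φ w) + (faceCorner (φ (φ w)) + 0))
      ≡⟨ cong₂ _+_ (no-corner refl (sym e₁)) (cong₂ _+_ (no-corner (sym e₁) (sym e₁₂))
           (cong (_+ 0) (no-corner (sym e₁₂) (cong col′ (inner-period w-inner))))) ⟩
    0 ∎)
    where
    open ≤-Reasoning
    e₁₂ = trans e₁ e₂
    no-corner : ∀ {z} → col′ z ≡ col′ w → col′ (φ z) ≡ col′ w → faceCorner z ≡ 0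
    no-corner z≡w φz≡w = trans (faceCorner-colours z≡w φz≡w) (switch-refl (col′ w))

  outer-corners : ∀ {m} → SameFace o m → F.orbitSum faceCorner m ≤ 2
  outer-corners {m} o~m = begin
    F.orbitSum faceCorner m
      ≤⟨ F.orbitSum-≤-iterates {4} faceCorner (s≤s z≤n) (outer-period o~m) ⟩
    faceCorner m + (faceCorner (φ m) + (faceCorner (φ (φ m)) + (faceCorner (φ (φ (φ m))) + 0)))
      ≡⟨ cong₂ _+_ (faceCorner-colours refl e₁) (cong₂ _+_ (faceCorner-colours e₁ e₂) (cong₂ _+_
           (faceCorner-colours e₂ e₃) (cong (_+ 0) (faceCorner-colours e₃ (cong col′ (outer-period o~m)))))) ⟩
    switch c c′ + (switch c′ c″ + (switch c″ c‴ + (switch c‴ c + 0)))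
      ≤⟨ switch-alternating c ⟩
    2 ∎
    where
    open ≤-Reasoning
    c = col′ m
    c′ = flip c
    c″ = flip c′
    c‴ = flip c″
    e₁ : col′ (φ m) ≡ c′
    e₁ = col′-φ-outer o~m
    e₂ : col′ (φ (φ m)) ≡ c″
    e₂ = trans (col′-φ-outer (outer-φ o~m)) (cong flip e₁)
    e₃ : col′ (φ (φ (φ m))) ≡ c‴
    e₃ = trans (col′-φ-outer (outer-φ (outer-φ o~m))) (cong flip e₂)

  face-corners : ∀ {w} → ¬ SameFace o w → Monochromatic w →
                 ∀ m → F.orbitSum faceCorner m + 𝟙 (m F.~? w) ≤ 1 + 𝟙 (m F.~? o)
  face-corners {w} w-inner mono m = by-face (m F.~? o) (m F.~? w)
    where
    by-face : (m~o? : Dec (F._~_ m o)) (m~w? : Dec (F._~_ m w)) → F.orbitSum faceCorner m + 𝟙 m~w? ≤ 1 + 𝟙 m~o?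
    by-face (yes m~o) (yes m~w) = ⊥-elim (w-inner (F.~-trans (F.~-sym m~o) m~w))
    by-face (yes m~o) (no _)    = subst (_≤ 2) (sym (+-identityʳ _)) (outer-corners (F.~-sym m~o))
    by-face (no _)    (yes m~w) = subst (λ k → k + 1 ≤ 1 + 0)
      (sym (trans (F.orbitSum-~ faceCorner m~w) (monochromatic-corners w-inner mono))) ≤-refl
    by-face (no m≁o)  (no _)    = subst (_≤ 1 + 0) (sym (+-identityʳ _)) (triangle-corners (m≁o ∘ F.~-sym))

  face-darts : ∀ m → 3 + 𝟙 (m F.~? o) ≤ F.orbitSum (λ _ → 1) m
  face-darts m = by-face (m F.~? o)
    where
    iterates-≤ : ∀ {L} → OrbitLength φ m L → sum {L} (λ _ → 1) ≤ F.orbitSum (λ _ → 1) m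
    iterates-≤ (_ , _ , exact) =
      F.∑-≤-orbitSum (λ _ → 1) (λ k → iter φ (toℕ k) m) (F.iterates-injective exact) (λ k → toℕ k , refl)
    by-face : (m~o? : Dec (F._~_ m o)) → 3 + 𝟙 m~o? ≤ F.orbitSum (λ _ → 1) m
    by-face (yes m~o) = iterates-≤ (F.orbitLength-transport (F.~-sym m~o) outerQuad)
    by-face (no m≁o)  = iterates-≤ (innerTri m (m≁o ∘ F.~-sym))

  no-monochromatic-face : ∀ {w} → ¬ SameFace o w → ¬ Monochromatic w
  no-monochromatic-face {w} w-inner mono =
    euler-contradiction {numOrbits σ} {numOrbits φ} vertex-bound face-bound dart-bound (proj₂ planar)
    where
    open ≤-Reasoning
    vertex-bound : 2 * numOrbits σ ≤ sum corner + 4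
    vertex-bound = begin
      2 * numOrbits σ
        ≡⟨ sym (V.∑ᵒ-const 2) ⟩
      V.∑ᵒ (λ _ → 2)
        ≤⟨ V.∑ᵒ-mono-≤ vertex-corners ⟩
      V.∑ᵒ (λ m → V.orbitSum corner m + 𝟙 (outer? m))
        ≡⟨ V.∑ᵒ-+ (V.orbitSum corner) (λ m → 𝟙 (outer? m)) ⟩
      V.∑ᵒ (V.orbitSum corner) + V.∑ᵒ (λ m → 𝟙 (outer? m))
        ≤⟨ +-mono-≤ (≤-reflexive (V.∑ᵒ-orbitSum corner)) (V.∑ᵒ-meeting-≤ a) ⟩
      sum corner + 4 ∎
    face-bound : sum corner ≤ numOrbits φ
    face-bound = +-cancelʳ-≤ 1 _ _ (begin
      sum corner + 1
        ≡⟨ sym (cong₂ _+_ (trans (F.∑ᵒ-orbitSum faceCorner) (F.sum-∘f corner)) (F.∑ᵒ-orbitOf w)) ⟩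
      F.∑ᵒ (F.orbitSum faceCorner) + F.∑ᵒ (λ m → 𝟙 (m F.~? w))
        ≡⟨ sym (F.∑ᵒ-+ (F.orbitSum faceCorner) (λ m → 𝟙 (m F.~? w))) ⟩
      F.∑ᵒ (λ m → F.orbitSum faceCorner m + 𝟙 (m F.~? w))
        ≤⟨ F.∑ᵒ-mono-≤ (face-corners w-inner mono) ⟩
      F.∑ᵒ (λ m → 1 + 𝟙 (m F.~? o))
        ≡⟨ F.∑ᵒ-+ (λ _ → 1) (λ m → 𝟙 (m F.~? o)) ⟩
      F.∑ᵒ (λ _ → 1) + F.∑ᵒ (λ m → 𝟙 (m F.~? o))
        ≡⟨ cong₂ _+_ (trans (F.∑ᵒ-const 1) (*-identityˡ _)) (F.∑ᵒ-orbitOf o) ⟩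
      numOrbits φ + 1 ∎)
    dart-bound : 3 * numOrbits φ + 1 ≤ n
    dart-bound = begin
      3 * numOrbits φ + 1                          ≡⟨ sym (cong₂ _+_ (F.∑ᵒ-const 3) (F.∑ᵒ-orbitOf o)) ⟩
      F.∑ᵒ (λ _ → 3) + F.∑ᵒ (λ m → 𝟙 (m F.~? o))   ≡⟨ sym (F.∑ᵒ-+ (λ _ → 3) (λ m → 𝟙 (m F.~? o))) ⟩
      F.∑ᵒ (λ m → 3 + 𝟙 (m F.~? o))                ≤⟨ F.∑ᵒ-mono-≤ face-darts ⟩
      F.∑ᵒ (F.orbitSum (λ _ → 1))                  ≡⟨ F.∑ᵒ-orbitSum (λ _ → 1) ⟩
      sum {n} (λ _ → 1)                            ≡⟨ sum-one ⟩
      n                                            ∎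

-- The opening

module KeptHalfEdges (M : Map) (o : MapDefs.Dart M) (IT : MapDefs.Outer.IrreducibleTriangulation M o)
                     (col : MapDefs.Dart M → Color) (TR : MapDefs.Outer.Transversal M o col)
                     (dI : MapDefs.Dart M) (dI-inner : ¬ MapDefs.SameFace M o dI) where
  open Colouring M o IT col TR dI dI-inner public
  open Opening col public

  CcwSame : Dart → Set
  CcwSame h = InnerEdge h × InnerEdge (σ⁻ h) × col (σ⁻ h) ≡ col h

  InternalEnd : Dart → Set
  InternalEnd x = Kept x × (∀ h → NextInA x h → Closed h)

  twin-inner : ∀ {z} → InnerEdge z → InnerEdge (α z)
  twin-inner {z} (¬o~z , ¬o~αz) = ¬o~αz , λ o~ααz → ¬o~z (subst (SameFace o) (α-invol z) o~ααz)

  inner-φ²≡φ⁻ : ∀ {h} → ¬ SameFace o h → φ (φ h) ≡ φ⁻ h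
  inner-φ²≡φ⁻ {h} h-inner = F.f-injective (trans (inner-period h-inner) (sym (φ∘φ⁻ h)))

  kept-twin : ∀ {h} → InnerEdge h → InnerEdge (φ h) → col (φ h) ≢ col h → Kept (α h)
  kept-twin {h} h-inner φh-inner φh≢h = not-outer , colours-differ
    where
    colours-differ : col (σ (α h)) ≢ col (α h)
    colours-differ eq = φh≢h (trans eq (edgeColour h h-inner))
    not-outer : ¬ OuterVertex (α h)
    not-outer (i , a~αh) = colours-differ
      (trans (col-at-a i φh-inner (V.~-trans a~αh (1 , refl))) (sym (col-at-a i (twin-inner h-inner) a~αh)))

  ccw-same⇒φ-inner : ∀ {h} → CcwSame h → InnerEdge (φ h)
  ccw-same⇒φ-inner {h} (h-inner , σ⁻h-inner , same) = φh-not-outer , αφh-not-outer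
    where
    φh-not-outer : ¬ SameFace o (φ h)
    φh-not-outer o~φh = proj₁ h-inner (F.~-trans o~φh (F.~-sym (F.~-step h)))
    αφh-not-outer : ¬ SameFace o (α (φ h))
    αφh-not-outer o~αφh with outer-index o~αφh
    ... | j , αφh≡a = flip-≢ (aColour j) (begin
      flip (aColour j)     ≡⟨ sym (aColour-nxt4 j) ⟩
      aColour (nxt4 j)     ≡⟨ sym (col-at-a (nxt4 j) (twin-inner h-inner) (V.~-sym (2 , σ²αh≡a⁺))) ⟩
      col (α h)       ≡⟨ edgeColour h h-inner ⟩
      col h           ≡⟨ sym same ⟩
      col (σ⁻ h)      ≡⟨ sym (edgeColour (σ⁻ h) σ⁻h-inner) ⟩
      col (α (σ⁻ h))  ≡⟨ col-at-a j (twin-inner σ⁻h-inner) (1 , σa≡ασ⁻h) ⟩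
      aColour j            ∎)
      where
      open ≡-Reasoning
      σa≡ασ⁻h : σ (a j) ≡ α (σ⁻ h)
      σa≡ασ⁻h = trans (cong σ (sym αφh≡a)) (inner-φ²≡φ⁻ (proj₁ h-inner))
      σ²αh≡a⁺ : σ (σ (α h)) ≡ a (nxt4 j)
      σ²αh≡a⁺ = trans (σ-via-φ (φ h)) (trans (cong φ αφh≡a) (φ-a j))

  ccw-same⇒φ-colour : ∀ {h} → CcwSame h → col (φ h) ≢ col h
  ccw-same⇒φ-colour {h} c@(h-inner , σ⁻h-inner , same) eq = no-monochromatic-face (proj₁ h-inner) (e₁ , e₂)
    where
    col′-φh : col′ (φ h) ≡ col (φ h)
    col′-φh = col′-inner (ccw-same⇒φ-inner c)
    e₁ : col′ h ≡ col′ (φ h)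
    e₁ = trans (col′-inner h-inner) (sym (trans col′-φh eq))
    e₂ : col′ (φ h) ≡ col′ (φ (φ h))
    e₂ = begin
      col′ (φ h)       ≡⟨ trans col′-φh eq ⟩
      col h            ≡⟨ sym same ⟩
      col (σ⁻ h)       ≡⟨ sym (col′-inner σ⁻h-inner) ⟩
      col′ (σ⁻ h)      ≡⟨ sym (col′-α (σ⁻ h)) ⟩
      col′ (α (σ⁻ h))  ≡⟨ cong col′ (sym (inner-φ²≡φ⁻ (proj₁ h-inner))) ⟩
      col′ (φ (φ h))   ∎
      where open ≡-Reasoning

  ccw-same⇒kept-twin : ∀ {h} → CcwSame h → Kept (α h)
  ccw-same⇒kept-twin c = kept-twin (proj₁ c) (ccw-same⇒φ-inner c) (ccw-same⇒φ-colour c)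

  colour-run : ∀ {x k} → ¬ OuterVertex x → (∀ j → 0 < j → j < k → ¬ Kept (iter σ j x)) →
               ∀ j → 0 < j → j ≤ k → col (iter σ j x) ≡ col (σ x)
  colour-run x-inner not-kept (suc zero)    _ _   = refl
  colour-run {x} x-inner not-kept (suc (suc j)) _ j<k =
    trans (colour-stable λ ≢ → not-kept (suc j) (s≤s z≤n) j<k (not-outer , ≢))
          (colour-run x-inner not-kept (suc j) (s≤s z≤n) (≤-trans (n≤1+n _) j<k))
    where
    not-outer : ¬ OuterVertex (iter σ (suc j) x)
    not-outer (i , a~σʲx) = x-inner (i , V.~-trans a~σʲx (V.~-sym (suc j , refl)))

  internal-twin-end : ∀ {h} → CcwSame h → InternalEnd (α h)
  internal-twin-end {h} c@(h-inner , σ⁻h-inner , same) = kept-x , next-closed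
    where
    x = α h
    kept-x : Kept x
    kept-x = ccw-same⇒kept-twin c
    around-x : ∀ k → InnerEdge (iter σ k x)
    around-x k = inner-around (proj₁ kept-x) (k , refl)
    twin-kept : ∀ k → 0 < k → (∀ j → 0 < j → j < k → ¬ Kept (iter σ j x)) → Kept (α (iter σ k x))
    twin-kept (suc zero) _ _ = kept-twin (around-x 1) φσx-inner λ eq → proj₂ kept-x (sym (begin
      col x              ≡⟨ edgeColour h h-inner ⟩
      col h              ≡⟨ sym same ⟩
      col (σ⁻ h)         ≡⟨ sym (edgeColour (σ⁻ h) σ⁻h-inner) ⟩
      col (α (σ⁻ h))     ≡⟨ cong col (sym (inner-φ²≡φ⁻ (proj₁ h-inner))) ⟩
      col (φ (σ x))      ≡⟨ eq ⟩
      col (σ x)          ∎))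
      where
      open ≡-Reasoning
      φσx-inner : InnerEdge (φ (σ x))
      φσx-inner = subst InnerEdge (sym (inner-φ²≡φ⁻ (proj₁ h-inner))) (twin-inner σ⁻h-inner)
    twin-kept (suc (suc k)) _ not-kept = ccw-same⇒kept-twin
      (around-x (suc (suc k)) , subst InnerEdge (sym (σ⁻σ _)) (around-x (suc k)) ,
       trans (cong col (σ⁻σ _)) (trans (run (suc k) (s≤s z≤n) (n≤1+n _)) (sym (run (suc (suc k)) (s≤s z≤n) ≤-refl))))
      where
      run : ∀ j → 0 < j → j ≤ suc (suc k) → col (iter σ j x) ≡ col (σ x)
      run = colour-run (proj₁ kept-x) not-kept
    next-closed : ∀ h′ → NextInA x h′ → Closed h′
    next-closed _ (k , 0<k , refl , kept-h′ , not-kept) = kept-h′ , twin-kept k 0<k not-kept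

  internal-of-ends : ∀ {x} → InternalEnd x → InternalEnd (α x) → InternalA x
  internal-of-ends (kept-x , next-x) (kept-αx , next-αx) = (kept-x , kept-αx) , next-x , next-αx

lemma29 : (M : Map) (o : MapDefs.Dart M) →
    MapDefs.Outer.IrreducibleTriangulation M o →
    ∀ (col : MapDefs.Dart M → Color) →
    MapDefs.Outer.Transversal M o col → MapDefs.Outer.Minimal M o col →
    ∀ (d : MapDefs.Dart M) (c : Color) →
    MapDefs.Outer.CcwInternal M o col d → col d ≡ c →
    MapDefs.Outer.Opening.InternalA M o col d
      × MapDefs.Outer.Opening.colA M o col d ≡ c
lemma29 M o IT col TR _ d c (d-inner , (σ⁻d-inner , same-d) , (σ⁻αd-inner , same-αd)) col≡c =
  internal-of-ends end-d end-αd , col≡c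
  where
  open KeptHalfEdges M o IT col TR d (proj₁ d-inner)
  end-d : InternalEnd d
  end-d = subst InternalEnd (α-invol d) (internal-twin-end (twin-inner d-inner , σ⁻αd-inner , same-αd))
  end-αd : InternalEnd (α d)
  end-αd = internal-twin-end (d-inner , σ⁻d-inner , same-d)
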